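{- In the game \textsc{saliquant}, $\mathcal{SG}(2^b)=2^{b-1}-1$ for every integer $b\geq 1$. In particular, there are infinitely many positive integers $n$ with $\mathcal{SG}(n)=\frac{n-2}{2}$.
   Context: \textsc{saliquant} is the normal-play impartial game whose positions are the positive integers, where the options of a position $n\geq 1$ are $\{n-k : 1\leq k\leq n,\ k\nmid n\}$. The nim-value is defined recursively by $\mathcal{SG}(n)=\operatorname{mex}\{\mathcal{SG}(x) : x \text{ an option of } n\}$, where $\operatorname{mex}(A)$ is the least nonnegative integer not in $A$. -}

module Defs where

open import Data.Nat using (ℕ; zero; suc; _+_; _∸_; _≡ᵇ_)
open import Data.Nat.Divisibility using (_∣?_)
open import Data.Bool using (Bool; true; false; if_then_else_; not; _∨_)
open import Data.List using (List; []; _∷_; _++_; map; filter; length; upTo)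
open import Data.Bool.ListAction using (any)
open import Relation.Nullary.Decidable using (⌊_⌋; ¬?)

-- mex of a finite list of naturals: least natural not in the list.
-- Searching among 0 .. length xs suffices.
_∈ᵇ_ : ℕ → List ℕ → Bool
x ∈ᵇ xs = any (λ y → x ≡ᵇ y) xs

mexFrom : ℕ → ℕ → List ℕ → ℕ
mexFrom zero    i xs = i
mexFrom (suc f) i xs = if i ∈ᵇ xs then mexFrom f (suc i) xs else i

mex : List ℕ → ℕ
mex xs = mexFrom (length xs) 0 xs

-- Saliquant moves: from n ≥ 1, subtract k with 1 ≤ k ≤ n and k ∤ n.
-- The list of subtracted amounts k (non-divisors of n in 1..n).
nonDivisors : ℕ → List ℕ
nonDivisors n = filter (λ k → ¬? (k ∣? n)) (map suc (upTo n))

options : ℕ → List ℕ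
options n = map (λ k → n ∸ k) (nonDivisors n)

index : List ℕ → ℕ → ℕ
index []       _       = 0
index (x ∷ xs) zero    = x
index (x ∷ xs) (suc i) = index xs i

-- sgTable n = [SG(0), SG(1), ..., SG(n)]  (SG(0) is a dummy 0; position 0
-- never occurs as an option since k = n always divides n).
sgTable : ℕ → List ℕ
sgTable zero    = 0 ∷ []
sgTable (suc n) = let t = sgTable n in
                  t ++ (mex (map (index t) (options (suc n))) ∷ [])

SG : ℕ → ℕ
SG n = index (sgTable n) n

-- By strong induction SG (n + 1) ≤ ⌊n/2⌋: an option m = k + 1 of n + 1 has SG m ≤ ⌊k/2⌋, and
-- k ≤ n - 2 because the move to m = n (subtracting 1, a divisor) is forbidden, so the value
-- ⌊n/2⌋ is missing among the options.  Equality holds once every odd 2w + 1 with w < ⌊n/2⌋ is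
-- an option of n + 1, since SG (2w + 1) = w then fills 0, ..., ⌊n/2⌋ - 1.  For n + 1 = 2j + 1
-- the differences 2(j - w) are even, and for n + 1 = 2^b the differences 2(j - w) + 1 are odd
-- and greater than 1; in neither case do they divide n + 1.
module Submission where

open import Defs
open import Data.Nat
open import Data.Nat.Properties
open import Data.Nat.Divisibility
open import Data.Nat.Coprimality using (Coprime; coprime-divisor; coprime-+; 1-coprimeTo)
open import Data.Nat.Induction using (<-rec)
open import Data.Bool using (true; false; T)
open import Data.Fin using (Fin; toℕ)
open import Data.Fin.Properties using (toℕ<n; pigeonhole)
open import Data.List using ([]; _∷_; _++_; map; length; lookup; upTo)
open import Data.List.Properties using (length-++; map-cong-local)
open import Data.List.Membership.Propositional using (_∈_; _∉_)
open import Data.List.Membership.Propositional.Properties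
  using (∈-map⁺; ∈-map⁻; ∈-filter⁺; ∈-filter⁻; ∈-upTo⁺; ∈-upTo⁻)
import Data.List.Relation.Unary.All as All
import Data.List.Relation.Unary.Any as Any
open import Data.List.Relation.Unary.Any.Properties using (any⁺; any⁻; lookup-index)
open import Data.Product using (_×_; _,_; proj₁; ∃-syntax)
open import Data.Sum using (inj₁; inj₂)
open import Relation.Nullary using (¬_; contradiction)
open import Relation.Nullary.Decidable using (¬?)
open import Function using (_∘_)
open import Relation.Binary.PropositionalEquality

2*⌊n/2⌋≤n : ∀ n → 2 * ⌊ n /2⌋ ≤ n
2*⌊n/2⌋≤n zero          = z≤n
2*⌊n/2⌋≤n (suc zero)    = z≤n
2*⌊n/2⌋≤n (suc (suc n)) = subst (_≤ suc (suc n)) (sym (*-suc 2 ⌊ n /2⌋)) (s≤s (s≤s (2*⌊n/2⌋≤n n)))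

⌊2n/2⌋≡n : ∀ n → ⌊ 2 * n /2⌋ ≡ n
⌊2n/2⌋≡n n = trans (cong (λ m → ⌊ n + m /2⌋) (+-identityʳ n)) (sym (n≡⌊n+n/2⌋ n))

⌊1+2n/2⌋≡n : ∀ n → ⌊ suc (2 * n) /2⌋ ≡ n
⌊1+2n/2⌋≡n zero    = refl
⌊1+2n/2⌋≡n (suc n) = trans (cong (λ m → ⌊ suc m /2⌋) (*-suc 2 n)) (cong suc (⌊1+2n/2⌋≡n n))

2∤1+2n : ∀ n → ¬ (2 ∣ suc (2 * n))
2∤1+2n n (divides q eq) = even≢odd q n (sym (trans eq (*-comm q 2)))

coprime-1+2n-2 : ∀ n → Coprime (suc (2 * n)) 2
coprime-1+2n-2 zero    = 1-coprimeTo 2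
coprime-1+2n-2 (suc n) =
  subst (λ m → Coprime m 2) (cong suc (sym (*-suc 2 n))) (coprime-+ (coprime-1+2n-2 n))

coprime∣^⇒≡1 : ∀ {d m} c → Coprime d m → d ∣ m ^ c → d ≡ 1
coprime∣^⇒≡1 zero    _   d∣1   = ∣1⇒≡1 d∣1
coprime∣^⇒≡1 (suc c) cop d∣m^c = coprime∣^⇒≡1 c cop (coprime-divisor cop d∣m^c)

1+2n∣2^⇒n≡0 : ∀ {n} b → suc (2 * n) ∣ 2 ^ b → n ≡ 0
1+2n∣2^⇒n≡0 {n} b d = *-cancelˡ-≡ n 0 2 (suc-injective (coprime∣^⇒≡1 b (coprime-1+2n-2 n) d))

n<2^n : ∀ n → n < 2 ^ n
n<2^n zero    = z<s
n<2^n (suc n) = begin-strict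
  suc n             ≤⟨ n<2^n n ⟩
  2 ^ n             <⟨ m<m+n (2 ^ n) (≤-trans (m^n>0 2 n) (m≤m+n (2 ^ n) 0)) ⟩
  2 ^ n + 1 * 2 ^ n ∎
  where open ≤-Reasoning

2^suc≡2+2*[2^∸1] : ∀ c → 2 ^ suc c ≡ 2 + 2 * (2 ^ c ∸ 1)
2^suc≡2+2*[2^∸1] c = trans (cong (2 *_) (sym (m+[n∸m]≡n (m^n>0 2 c)))) (*-suc 2 (2 ^ c ∸ 1))

∈ᵇ⇒∈ : ∀ {x xs} → x ∈ᵇ xs ≡ true → x ∈ xs
∈ᵇ⇒∈ {xs = xs} e = Any.map (≡ᵇ⇒≡ _ _) (any⁻ _ xs (subst T (sym e) _))

∈ᵇ≡false⇒∉ : ∀ {x xs} → x ∈ᵇ xs ≡ false → x ∉ xs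
∈ᵇ≡false⇒∉ e x∈xs = subst T e (any⁺ _ (Any.map (≡⇒≡ᵇ _ _) x∈xs))

-- The fuel length xs of mex suffices by the pigeonhole principle: the positions in xs of the
-- values 0, ..., v - 1 are pairwise distinct.
covering⇒≤length : ∀ {v} xs → (∀ {w} → w < v → w ∈ xs) → v ≤ length xs
covering⇒≤length {v} xs cover = ≮⇒≥ λ length<v →
  let i , j , i<j , same = pigeonhole length<v position
  in  <⇒≢ i<j (trans (valueAt i) (trans (cong (lookup xs) same) (sym (valueAt j))))
  where
  position : Fin v → Fin (length xs)
  position i = Any.index (cover (toℕ<n i))

  valueAt : ∀ i → toℕ i ≡ lookup xs (position i)
  valueAt i = lookup-index (cover (toℕ<n i))

mexFrom-≤ : ∀ fuel {i v} xs → i ≤ v → v ∉ xs → mexFrom fuel i xs ≤ v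
mexFrom-≤ zero       xs i≤v _   = i≤v
mexFrom-≤ (suc fuel) {i} xs i≤v v∉xs with i ∈ᵇ xs in e
... | false = i≤v
... | true with m≤n⇒m<n∨m≡n i≤v
...   | inj₁ i<v  = mexFrom-≤ fuel xs i<v v∉xs
...   | inj₂ refl = contradiction (∈ᵇ⇒∈ e) v∉xs

mexFrom-≥ : ∀ fuel {i v} xs → v ≤ i + fuel → (∀ {w} → w < v → w ∈ xs) → v ≤ mexFrom fuel i xs
mexFrom-≥ zero       {i} xs v≤i _ = subst (_ ≤_) (+-identityʳ i) v≤i
mexFrom-≥ (suc fuel) {i} {v} xs v≤i+fuel cover with i ∈ᵇ xs in e
... | true  = mexFrom-≥ fuel xs (subst (v ≤_) (+-suc i fuel) v≤i+fuel) cover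
... | false = ≮⇒≥ (λ i<v → ∈ᵇ≡false⇒∉ e (cover i<v))

mex-≤ : ∀ {v} xs → v ∉ xs → mex xs ≤ v
mex-≤ xs = mexFrom-≤ (length xs) xs z≤n

mex-≥ : ∀ {v} xs → (∀ {w} → w < v → w ∈ xs) → v ≤ mex xs
mex-≥ xs cover = mexFrom-≥ (length xs) xs (covering⇒≤length xs cover) cover

∈-options⁻ : ∀ {m n} → m ∈ options n → m < n × ¬ (n ∸ m ∣ n)
∈-options⁻ {n = n} p
  with k , k∈ , refl ← ∈-map⁻ (n ∸_) p
  with k∈range , k∤n ← ∈-filter⁻ (λ k → ¬? (k ∣? n)) {xs = map suc (upTo n)} k∈
  with i , i∈ , refl ← ∈-map⁻ suc k∈range
  = ∸-monoʳ-< z<s (∈-upTo⁻ i∈) , k∤n ∘ subst (_∣ n) (m∸[m∸n]≡n (∈-upTo⁻ i∈))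

∈-options⁺ : ∀ {m n} → m < n → ¬ (n ∸ m ∣ n) → m ∈ options n
∈-options⁺ {m} {suc n} (s≤s m≤n) n+1-m∤n+1 =
  subst (_∈ options (suc n)) (m∸[m∸n]≡n (m≤n⇒m≤1+n m≤n)) (∈-map⁺ (suc n ∸_) n+1-m∈nonDivisors)
  where
  n+1-m∈nonDivisors : suc n ∸ m ∈ nonDivisors (suc n)
  n+1-m∈nonDivisors = ∈-filter⁺ (λ k → ¬? (k ∣? suc n))
    (subst (_∈ map suc (upTo (suc n))) (sym (+-∸-assoc 1 m≤n)) (∈-map⁺ suc (∈-upTo⁺ (s≤s (m∸n≤m n m)))))
    n+1-m∤n+1

length-sgTable : ∀ n → length (sgTable n) ≡ suc n
length-sgTable zero    = refl
length-sgTable (suc n) =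
  trans (length-++ (sgTable n)) (trans (cong (_+ 1) (length-sgTable n)) (+-comm (suc n) 1))

index-++ˡ : ∀ t ys {i} → i < length t → index (t ++ ys) i ≡ index t i
index-++ˡ (x ∷ t) ys {zero}  _         = refl
index-++ˡ (x ∷ t) ys {suc i} (s≤s i<t) = index-++ˡ t ys i<t

index-++-length : ∀ t x → index (t ++ x ∷ []) (length t) ≡ x
index-++-length []      x = refl
index-++-length (y ∷ t) x = index-++-length t x

index-sgTable : ∀ {i} n → i ≤ n → index (sgTable n) i ≡ SG i
index-sgTable zero    z≤n = refl
index-sgTable (suc n) i≤1+n with m≤n⇒m<n∨m≡n i≤1+n
... | inj₂ refl      = refl
... | inj₁ (s≤s i≤n) = trans (index-++ˡ (sgTable n) _ (subst (_ <_) (sym (length-sgTable n)) (s≤s i≤n)))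
                             (index-sgTable n i≤n)

SG-suc : ∀ n → SG (suc n) ≡ mex (map SG (options (suc n)))
SG-suc n = begin
  SG (suc n)                                ≡⟨ subst (λ i → index (sgTable n ++ value ∷ []) i ≡ value)
                                                     (length-sgTable n) (index-++-length (sgTable n) value) ⟩
  value                                     ≡⟨ cong mex (map-cong-local (All.tabulate tableEntry)) ⟩
  mex (map SG (options (suc n)))            ∎
  where
  open ≡-Reasoning
  value : ℕ
  value = mex (map (index (sgTable n)) (options (suc n)))

  tableEntry : ∀ {m} → m ∈ options (suc n) → index (sgTable n) m ≡ SG m
  tableEntry m∈ = index-sgTable n (≤-pred (proj₁ (∈-options⁻ m∈)))

SG-option-< : ∀ {n m} → (∀ {k} → k < n → SG (suc k) ≤ ⌊ k /2⌋) →
              m ∈ options (suc n) → SG m < ⌊ n /2⌋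
SG-option-< {n} {m} below m∈ with ∈-options⁻ m∈
SG-option-< {n} {zero}   below m∈ | _         , n+1∤n+1 = contradiction ∣-refl n+1∤n+1
SG-option-< {n} {suc m}  below m∈ | s≤s m+1≤n , n-m∤n+1 with m≤n⇒m<n∨m≡n m+1≤n
... | inj₂ refl  = contradiction (subst (_∣ suc n) (sym (m+n∸n≡m 1 m)) (1∣ suc n)) n-m∤n+1
... | inj₁ m+2≤n = begin-strict
  SG (suc m)           ≤⟨ below m+1≤n ⟩
  ⌊ m /2⌋              <⟨ n<1+n ⌊ m /2⌋ ⟩
  ⌊ suc (suc m) /2⌋    ≤⟨ ⌊n/2⌋-mono m+2≤n ⟩
  ⌊ n /2⌋              ∎
  where open ≤-Reasoning

⌊n/2⌋∉SG[options] : ∀ {n} → (∀ {k} → k < n → SG (suc k) ≤ ⌊ k /2⌋) →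
                    ⌊ n /2⌋ ∉ map SG (options (suc n))
⌊n/2⌋∉SG[options] below p with m , m∈ , eq ← ∈-map⁻ SG p = <-irrefl (sym eq) (SG-option-< below m∈)

SG-suc-≤ : ∀ n → SG (suc n) ≤ ⌊ n /2⌋
SG-suc-≤ = <-rec _ λ n below →
  subst (_≤ ⌊ n /2⌋) (sym (SG-suc n)) (mex-≤ _ (⌊n/2⌋∉SG[options] below))

SG-suc-≡ : ∀ {n} → (∀ {w} → w < ⌊ n /2⌋ → SG (suc (2 * w)) ≡ w) →
           (∀ {w} → w < ⌊ n /2⌋ → ¬ (n ∸ 2 * w ∣ suc n)) → SG (suc n) ≡ ⌊ n /2⌋
SG-suc-≡ {n} SG[2w+1]≡w n-2w∤n+1 =
  ≤-antisym (SG-suc-≤ n) (subst (⌊ n /2⌋ ≤_) (sym (SG-suc n)) (mex-≥ _ attained))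
  where
  attained : ∀ {w} → w < ⌊ n /2⌋ → w ∈ map SG (options (suc n))
  attained {w} w<n/2 = subst (_∈ _) (SG[2w+1]≡w w<n/2) (∈-map⁺ SG (∈-options⁺ 2w+1<n+1 (n-2w∤n+1 w<n/2)))
    where
    2w+1<n+1 : suc (2 * w) < suc n
    2w+1<n+1 = s≤s (<-≤-trans (*-monoʳ-< 2 w<n/2) (2*⌊n/2⌋≤n n))

SG-odd : ∀ j → SG (suc (2 * j)) ≡ j
SG-odd = <-rec _ λ j SG-odd-below →
  let w<j : ∀ {w} → w < ⌊ 2 * j /2⌋ → w < j
      w<j = subst (_ <_) (⌊2n/2⌋≡n j)
      2j-2w∤2j+1 : ∀ w → ¬ (2 * j ∸ 2 * w ∣ suc (2 * j))
      2j-2w∤2j+1 w d = 2∤1+2n j (∣-trans (subst (2 ∣_) (*-distribˡ-∸ 2 j w) (m∣m*n (j ∸ w))) d)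
  in  trans (SG-suc-≡ (SG-odd-below ∘ w<j) (λ {w} _ → 2j-2w∤2j+1 w)) (⌊2n/2⌋≡n j)

SG-2+2j : ∀ {b j} → 2 ^ b ≡ 2 + 2 * j → SG (2 + 2 * j) ≡ j
SG-2+2j {b} {j} 2^b≡2+2j =
  trans (SG-suc-≡ (λ {w} _ → SG-odd w) (2j+1-2w∤2j+2 ∘ w<j)) (⌊1+2n/2⌋≡n j)
  where
  w<j : ∀ {w} → w < ⌊ suc (2 * j) /2⌋ → w < j
  w<j = subst (_ <_) (⌊1+2n/2⌋≡n j)

  2j+1-2w∤2j+2 : ∀ {w} → w < j → ¬ (suc (2 * j) ∸ 2 * w ∣ 2 + 2 * j)
  2j+1-2w∤2j+2 {w} w<j d =
    <⇒≢ (m<n⇒0<n∸m w<j) (sym (1+2n∣2^⇒n≡0 b (subst₂ _∣_ difference (sym 2^b≡2+2j) d)))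
    where
    difference : suc (2 * j) ∸ 2 * w ≡ suc (2 * (j ∸ w))
    difference = trans (+-∸-assoc 1 (*-monoʳ-≤ 2 (<⇒≤ w<j))) (cong suc (sym (*-distribˡ-∸ 2 j w)))

SG-2^ : ∀ c → SG (2 ^ suc c) ≡ 2 ^ c ∸ 1
SG-2^ c = trans (cong SG (2^suc≡2+2*[2^∸1] c)) (SG-2+2j {suc c} (2^suc≡2+2*[2^∸1] c))

mainTheorem12 : ((b : ℕ) → 1 ≤ b → SG (2 ^ b) ≡ 2 ^ (b ∸ 1) ∸ 1)
    × ((m : ℕ) → ∃[ n ] (n > m × 2 * SG n + 2 ≡ n))
mainTheorem12 = SG-power , infinitelyMany
  where
  SG-power : (b : ℕ) → 1 ≤ b → SG (2 ^ b) ≡ 2 ^ (b ∸ 1) ∸ 1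
  SG-power (suc c) _ = SG-2^ c

  infinitelyMany : (m : ℕ) → ∃[ n ] (n > m × 2 * SG n + 2 ≡ n)
  infinitelyMany m = 2 ^ suc m , <⇒≤ (n<2^n (suc m)) , (begin
    2 * SG (2 ^ suc m) + 2      ≡⟨ cong (λ s → 2 * s + 2) (SG-2^ m) ⟩
    2 * (2 ^ m ∸ 1) + 2         ≡⟨ +-comm (2 * (2 ^ m ∸ 1)) 2 ⟩
    2 + 2 * (2 ^ m ∸ 1)         ≡⟨ sym (2^suc≡2+2*[2^∸1] m) ⟩
    2 ^ suc m                   ∎)
    where open ≡-Reasoning
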